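{- Let $m\ge0$ and let $\lambda\in Q_4(m,n)$ have $m$-Durfee rectangle symbol $(\alpha,\beta)_{(m+j)\times j}$ with $\alpha=(\alpha_1,\ldots,\alpha_s)$ and $\beta=(\beta_1,\ldots,\beta_t)$. Then there exists an integer $k$ with $1\le k\le s$ such that $\alpha_{k+1}\le\beta_k-1$ and $\alpha_k\ge\beta_{k+1}-1$ (where $\alpha_i=0$ for $i>s$ and $\beta_i=0$ for $i>t$).
   Context: Partitions: $\ell(\mu)$ is the number of parts, $s(\mu)$ the smallest part, rank of $\lambda$ is $\lambda_1-\ell(\lambda)$. The rank-set of $\lambda=(\lambda_1\ge\cdots\ge\lambda_\ell>0)$ is $[-\lambda_1,1-\lambda_2,\ldots,\ell-1-\lambda_\ell,\ell,\ell+1,\ldots]$. Fix $m\ge0$. The $m$-Durfee rectangle of $\lambda$ is the largest rectangle with $m+j$ rows and $j$ columns inside the Ferrers diagram (so $j$ is the largest integer with $j=0$ or $\lambda_{m+j}\ge j$). The $m$-Durfee rectangle symbol is $(\alpha,\beta)_{(m+j)\times j}$ with $\alpha_i=\lambda'_{j+i}$ (column lengths to the right of the rectangle, $\lambda'$ the conjugate) and $\beta=(\lambda_{m+j+1},\ldots)$ (rows below the rectangle). $Q(m,n)$ is the set of partitions of $n$ with $m$ in the rank-set. $Q_4(m,n)$ is the set of $\lambda\in Q(m,n)$ whose symbol satisfies $j\ge1$, $\ell(\beta)-\ell(\alpha)\ge1$, $\alpha_1=m+j>\alpha_2$ and $s(\beta)\ge2$. -}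

module Defs where

open import Data.Nat using (ℕ; zero; suc; _+_; _∸_; _≤_; _<_; _≤ᵇ_)
open import Data.Integer as ℤ using (ℤ; +_)
open import Data.List using (List; []; _∷_; length; map; upTo; filterᵇ; drop)
open import Data.Nat.ListAction using (sum)
open import Data.List.Relation.Unary.All using (All)
open import Data.List.Relation.Unary.Linked using (Linked)
open import Data.Nat using (_≥_)
open import Data.Product using (Σ; ∃; _×_)
open import Data.Sum using (_⊎_)
open import Relation.Binary.PropositionalEquality using (_≡_)

IsPartitionOf : ℕ → List ℕ → Set
IsPartitionOf n la = Linked _≥_ la × All (1 ≤_) la × sum la ≡ n

at : List ℕ → ℕ → ℕ
at []       _       = 0
at (x ∷ xs) zero    = x
at (x ∷ xs) (suc i) = at xs i

-- 1-indexed entry μ_i, with μ_i = 0 for i > ℓ(μ) (and μ_0 := 0, never used).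
part : List ℕ → ℕ → ℕ
part xs zero    = 0
part xs (suc i) = at xs i

largest : List ℕ → ℕ
largest la = part la 1

-- conjugate: λ'_c = #{ i : λ_i ≥ c }
colLen : List ℕ → ℕ → ℕ
colLen la c = length (filterᵇ (c ≤ᵇ_) la)

-- z is in the rank-set [-λ₁, 1-λ₂, …, ℓ-1-λ_ℓ, ℓ, ℓ+1, …]
-- (entry number i+1, 0 ≤ i < ℓ, is i - λ_{i+1}; then all integers ≥ ℓ)
InRankSet : ℤ → List ℕ → Set
InRankSet z la =
  (Σ ℕ λ i → i < length la × (+ i) ℤ.- (+ part la (suc i)) ≡ z)
  ⊎ ((+ length la) ℤ.≤ z)

IsDurfee : ℕ → List ℕ → ℕ → Set
IsDurfee m la j =
  (j ≡ 0 ⊎ j ≤ part la (m + j)) ×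
  (∀ i → 1 ≤ i → i ≤ part la (m + i) → i ≤ j)

-- α = (λ'_{j+1}, …, λ'_{λ₁}) : column lengths right of the rectangle
alpha : List ℕ → ℕ → List ℕ
alpha la j = map (λ i → colLen la (suc (j + i))) (upTo (largest la ∸ j))

beta : ℕ → List ℕ → ℕ → List ℕ
beta m la j = drop (m + j) la

InQ : ℕ → ℕ → List ℕ → Set
InQ m n la = IsPartitionOf n la × InRankSet (+ m) la

Q4Cond : ℕ → List ℕ → ℕ → Set
Q4Cond m la j =
  1 ≤ j ×
  length (alpha la j) + 1 ≤ length (beta m la j) ×
  part (alpha la j) 1 ≡ m + j ×
  part (alpha la j) 2 < part (alpha la j) 1 ×
  All (2 ≤_) (beta m la j)

-- Put a k = α_k and b k = β_k. The condition b (k+1) ≤ a k + 1 holds at k = 1, because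
-- β₂ ≤ β₁ ≤ j ≤ m + j = α₁ by maximality of the Durfee rectangle, and a (k+1) + 1 ≤ b k holds
-- at k = s, because α_{s+1} = 0 while every part of β is at least 2. Walking up from k = 1,
-- whenever the second condition fails at k we get β_{k+2} ≤ β_k ≤ α_{k+1}, which is the first
-- condition at k + 1; so both hold simultaneously somewhere in [1, s].
module Submission where

open import Defs
open import Data.Nat using (ℕ; zero; suc; _+_; _∸_; _≤_; _≥_; z≤n; s≤s; _≤?_)
open import Data.Nat.Properties
open import Data.List using (List; []; _∷_; length; drop)
open import Data.List.Relation.Unary.All using (All; _∷_)
open import Data.List.Relation.Unary.Linked using (Linked; []; [-]; _∷_)
open import Data.Product using (∃-syntax; _×_; _,_)
open import Relation.Binary.PropositionalEquality using (_≡_; refl; sym; trans; cong; subst)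
open import Relation.Nullary using (¬_; yes; no; contradiction)
open import Relation.Unary using (Pred; Decidable)

module _ {p q} {P : Pred ℕ p} {Q : Pred ℕ q} (P? : Decidable P) {lo : ℕ}
         (step : ∀ {k} → lo ≤ k → Q k → ¬ P k → Q (suc k)) where

  first-crossing : ∀ {hi} → lo ≤ hi → Q lo → P hi → ∃[ k ] (lo ≤ k × k ≤ hi × P k × Q k)
  first-crossing {hi} lo≤hi Qlo Phi = go (hi ∸ lo) (m+[n∸m]≡n lo≤hi) ≤-refl Qlo
    where
    go : ∀ d {k} → k + d ≡ hi → lo ≤ k → Q k → ∃[ k ] (lo ≤ k × k ≤ hi × P k × Q k)
    go d {k} k+d≡hi lo≤k Qk with P? k
    ... | yes Pk = k , lo≤k , subst (k ≤_) k+d≡hi (m≤m+n k d) , Pk , Qk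
    go zero {k} k+0≡hi lo≤k Qk | no ¬Pk =
      contradiction (subst P (sym (trans (sym (+-identityʳ k)) k+0≡hi)) Phi) ¬Pk
    go (suc d) {k} k+1+d≡hi lo≤k Qk | no ¬Pk =
      go d (trans (sym (+-suc k d)) k+1+d≡hi) (m≤n⇒m≤1+n lo≤k) (step lo≤k Qk ¬Pk)

at-drop : ∀ n (xs : List ℕ) i → at (drop n xs) i ≡ at xs (n + i)
at-drop zero    xs       i = refl
at-drop (suc n) []       i = refl
at-drop (suc n) (x ∷ xs) i = at-drop n xs i

at-≥length : ∀ (xs : List ℕ) {i} → length xs ≤ i → at xs i ≡ 0
at-≥length []       _         = refl
at-≥length (x ∷ xs) (s≤s len) = at-≥length xs len

All-part : ∀ {p} {P : Pred ℕ p} {xs : List ℕ} → All P xs →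
  ∀ {i} → 1 ≤ i → i ≤ length xs → P (part xs i)
All-part (px ∷ _)   {suc zero}    _ _         = px
All-part (_  ∷ pxs) {suc (suc i)} _ (s≤s i≤) = All-part pxs (s≤s z≤n) i≤

Linked-drop : ∀ {r} {R : ℕ → ℕ → Set r} n {xs : List ℕ} → Linked R xs → Linked R (drop n xs)
Linked-drop zero    xs-linked       = xs-linked
Linked-drop (suc n) []              = []
Linked-drop (suc n) [-]             = Linked-drop n []
Linked-drop (suc n) (_ ∷ xs-linked) = Linked-drop n xs-linked

part-antitone : ∀ {xs : List ℕ} → Linked _≥_ xs → ∀ i → part xs (suc (suc i)) ≤ part xs (suc i)
part-antitone []               i       = z≤n
part-antitone [-]              i       = z≤n
part-antitone (x≥y ∷ _)        zero    = x≥y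
part-antitone (_ ∷ ys-linked)  (suc i) = part-antitone ys-linked i

length-pos : ∀ (xs : List ℕ) → 1 ≤ part xs 1 → 1 ≤ length xs
length-pos (x ∷ xs) _ = s≤s z≤n

durfee-beta₁ : ∀ {m la j} → IsDurfee m la j → part (beta m la j) 1 ≤ j
durfee-beta₁ {m} {la} {j} (_ , maximal) =
  ≮⇒≥ λ j<β₁ → 1+n≰n (maximal (suc j) (s≤s z≤n) (subst (suc j ≤_) β₁≡λ j<β₁))
  where
  β₁≡λ : part (beta m la j) 1 ≡ part la (m + suc j)
  β₁≡λ = trans (at-drop (m + j) la 0) (trans (cong (at la) (+-identityʳ (m + j)))
                                             (cong (part la) (sym (+-suc m j))))

overtake-step : ∀ (a b : ℕ → ℕ) → (∀ i → b (suc (suc i)) ≤ b (suc i)) →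
  ∀ {k} → 1 ≤ k → ¬ (a (suc k) + 1 ≤ b k) → b (suc (suc k)) ≤ a (suc k) + 1
overtake-step a b b-antitone {suc i} _ ¬overtaken =
  ≤-trans (b-antitone (suc i)) (≤-trans (b-antitone i) (<⇒≤ (≰⇒> ¬overtaken)))

proposition4p1 : (m n : ℕ) (la : List ℕ) (j : ℕ) →
    InQ m n la → IsDurfee m la j → Q4Cond m la j →
    ∃[ k ] (1 ≤ k × k ≤ length (alpha la j) ×
            part (alpha la j) (suc k) + 1 ≤ part (beta m la j) k ×
            part (beta m la j) (suc k) ≤ part (alpha la j) k + 1)
proposition4p1 m n la j ((decreasing , _) , _) durfee (1≤j , longer , α₁≡m+j , _ , β≥2) =
  first-crossing (λ k → a (suc k) + 1 ≤? b k) (λ 1≤k _ → overtake-step a b b-antitone 1≤k)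
                 1≤s start finish
  where
  α β : List ℕ
  α = alpha la j
  β = beta m la j

  a b : ℕ → ℕ
  a = part α
  b = part β

  s : ℕ
  s = length α

  b-antitone : ∀ i → b (suc (suc i)) ≤ b (suc i)
  b-antitone = part-antitone (Linked-drop (m + j) decreasing)

  1≤a₁ : 1 ≤ a 1
  1≤a₁ = subst (1 ≤_) (sym α₁≡m+j) (≤-trans 1≤j (m≤n+m j m))

  1≤s : 1 ≤ s
  1≤s = length-pos α 1≤a₁

  start : b 2 ≤ a 1 + 1
  start = begin
    b 2      ≤⟨ b-antitone 0 ⟩
    b 1      ≤⟨ durfee-beta₁ {m} {la} durfee ⟩
    j        ≤⟨ m≤n+m j m ⟩
    m + j    ≡⟨ α₁≡m+j ⟨
    a 1      ≤⟨ m≤m+n (a 1) 1 ⟩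
    a 1 + 1  ∎
    where open ≤-Reasoning

  finish : a (suc s) + 1 ≤ b s
  finish = subst (λ x → x + 1 ≤ b s) (sym (at-≥length α ≤-refl))
             (≤-trans (n≤1+n 1) (All-part β≥2 1≤s (m+n≤o⇒m≤o s longer)))
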